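{- Let $n\ge 0$ and let $a_0,\dots,a_n$, $b_0,\dots,b_n$, $c_1,\dots,c_n$ be nonnegative integers, and set $c_0=1$. Define $A_n,B_n,C_n$ as the entries of the first column of \[ \prod_{k=0}^{n}\begin{pmatrix} a_k & 1 & 0\\ b_k & 0 & 1\\ c_k & 0 & 0\end{pmatrix}=\begin{pmatrix} A_n & * & *\\ B_n & * & *\\ C_n & * & *\end{pmatrix}. \] Then: (1) $A_n$ equals the number of tilings of the board with cells $0,1,\dots,n$; (2) $B_n$ equals the number of tilings of the board with cells $-1,0,1,\dots,n$ whose first piece (the one covering cell $-1$) is a domino or a bar, where no square piece may be placed on cell $-1$; (3) $C_n$ equals the number of tilings of the board with cells $1,\dots,n$ (for $n=0$ this is the empty board, which has exactly one, empty, tiling).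
   Context: A board with cells $m,m+1,\dots,n$ (consecutive integers) is tiled as follows. A tiling is a partition of the set of cells into blocks of consecutive cells of length $1$ (a stack of squares), $2$ (a stack of dominoes) or $3$ (a stack of bars), each block contained in the board, together with a choice of stack height for each block: a length-1 block $\{i\}$ receives a height in $\{1,\dots,a_i\}$ ($a_i$ choices); a length-2 block $\{i-1,i\}$ receives a height in $\{1,\dots,b_i\}$ ($b_i$ choices); a length-3 block $\{i-2,i-1,i\}$ receives a height in $\{1,\dots,c_i\}$ ($c_i$ choices). Thus the number of tilings is the sum, over all partitions into such blocks, of the product of the corresponding numbers $a_i$, $b_i$, $c_i$ (indexed by the last cell of each block). Here the height conditions used are $(a_0,\dots,a_n)$, $(b_0,\dots,b_n)$, $(c_0,\dots,c_n)$ in parts (1) and (2) (in part (2), a domino on cells $\{ -1,0\}$ uses $b_0$ and a bar on $\{ -1,0,1\}$ uses $c_1$), and $(a_1,\dots,a_n)$, $(b_1,\dots,b_n)$, $(c_1,\dots,c_n)$ in part (3). $(A_n/C_n,B_n/C_n)$ is the $n$-th convergent of the multidimensional continued fraction with partial quotients $(a_i),(b_i),(c_i)$. -}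

module Defs where

open import Data.Nat as ℕ using (ℕ; zero; suc)
open import Data.Integer as ℤ using (ℤ; +_; -[1+_])
open import Data.Fin using (Fin; zero; suc)
open import Data.Unit using (⊤)
open import Data.Empty using (⊥)

Mat : Set
Mat = Fin 3 → Fin 3 → ℕ

_⊗_ : Mat → Mat → Mat
(X ⊗ Y) i j = ℕ._+_ (ℕ._*_ (X i zero) (Y zero j))
               (ℕ._+_ (ℕ._*_ (X i (suc zero)) (Y (suc zero) j))
                      (ℕ._*_ (X i (suc (suc zero))) (Y (suc (suc zero)) j)))

stepMat : (a b c : ℕ → ℕ) → ℕ → Mat
stepMat a b c k zero          zero                = a k
stepMat a b c k zero          (suc zero)          = 1
stepMat a b c k zero          (suc (suc zero))    = 0
stepMat a b c k (suc zero)    zero                = b k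
stepMat a b c k (suc zero)    (suc zero)          = 0
stepMat a b c k (suc zero)    (suc (suc zero))    = 1
stepMat a b c k (suc (suc zero)) zero             = c k
stepMat a b c k (suc (suc zero)) (suc zero)       = 0
stepMat a b c k (suc (suc zero)) (suc (suc zero)) = 0

prodMat : (a b c : ℕ → ℕ) → ℕ → Mat
prodMat a b c zero    = stepMat a b c zero
prodMat a b c (suc n) = prodMat a b c n ⊗ stepMat a b c (suc n)

A B C : (a b c : ℕ → ℕ) → ℕ → ℕ
A a b c n = prodMat a b c n zero zero
B a b c n = prodMat a b c n (suc zero) zero
C a b c n = prodMat a b c n (suc (suc zero)) zero

-- Height conditions are sequences indexed by integer cells
-- (indexed by the LAST cell of each block).  A sequence ℕ → ℕ is
-- extended to ℤ by 0 on negative cells; this is only ever consulted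
-- for a square on cell -1 in part (2), which is excluded explicitly there.

ext : (ℕ → ℕ) → ℤ → ℕ
ext f (+ k)    = f k
ext f -[1+ k ] = 0

-- Tiling a b c m L : tilings of the board with the L consecutive cells
-- m, m+1, …, m+L-1, listed from the left.  A block is a square, domino
-- or bar starting at the leftmost uncovered cell, together with a
-- height in {1,…,h} represented by Fin h, where h is a_i, b_i or c_i
-- for i the last cell of the block.
data Tiling (a b c : ℤ → ℕ) : ℤ → ℕ → Set where
  empty  : ∀ {m} → Tiling a b c m 0
  square : ∀ {m L} → Fin (a m)
         → Tiling a b c (m ℤ.+ + 1) L → Tiling a b c m (suc L)
  domino : ∀ {m L} → Fin (b (m ℤ.+ + 1))
         → Tiling a b c (m ℤ.+ + 2) L → Tiling a b c m (suc (suc L))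
  bar    : ∀ {m L} → Fin (c (m ℤ.+ + 2))
         → Tiling a b c (m ℤ.+ + 3) L → Tiling a b c m (suc (suc (suc L)))

FirstNotSquare : ∀ {a b c m L} → Tiling a b c m L → Set
FirstNotSquare empty          = ⊤
FirstNotSquare (square _ _)   = ⊥
FirstNotSquare (domino _ _)   = ⊤
FirstNotSquare (bar _ _)      = ⊤

-- The first column of Mₛ ⊗ P is (aₛ p₀ + p₁ , bₛ p₀ + p₂ , cₛ p₀), where p is the first
-- column of P.  This is the decomposition of a tiling by its first piece: a square on
-- cell s, or a piece started one or two cells earlier that ends on s.  So, by induction
-- along the right-nested product Mₛ ⋯ Mₛ₊ₗ (equal to the left-nested one by
-- associativity), its first column counts the tilings of the cells s, …, s + L, the
-- tilings of s − 1, …, s + L beginning with a domino or a bar, and the tilings of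
-- s − 2, …, s + L beginning with a bar.

module Submission where

open import Defs
open import Data.Nat using (ℕ; zero; suc; _+_; _*_)
open import Data.Nat.Properties using (+-comm; +-suc; +-identityʳ; *-identityˡ; *-identityʳ)
open import Data.Nat.Tactic.RingSolver using (solve-∀)
open import Data.Integer as ℤ using (ℤ; +_; -[1+_])
import Data.Integer.Properties as ℤ
open import Data.Fin using (Fin; zero)
open import Data.Fin.Patterns using (0F; 1F; 2F)
open import Data.Fin.Properties using (+↔⊎; *↔×; 0↔⊥)
open import Data.Product using (Σ; _×_; _,_)
open import Data.Product.Function.NonDependent.Propositional using (_×-↔_)
open import Data.Sum using (_⊎_; inj₁; inj₂)
open import Data.Sum.Function.Propositional using (_⊎-↔_)
open import Data.Empty using (⊥)
open import Data.Unit using (tt)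
open import Function.Bundles using (_↔_; mk↔ₛ′)
open import Function.Properties.Inverse using (↔-refl; ↔-sym; ↔-trans)
open import Relation.Binary.PropositionalEquality
  using (_≡_; refl; sym; trans; cong; cong₂; module ≡-Reasoning)

Fin-cong : ∀ {m n} → m ≡ n → Fin m ↔ Fin n
Fin-cong refl = ↔-refl

×⊎↔*+ : ∀ {P Q : Set} {x y z} → P ↔ Fin y → Q ↔ Fin z → ((Fin x × P) ⊎ Q) ↔ Fin (x * y + z)
×⊎↔*+ P↔ Q↔ = ↔-trans ((↔-refl ×-↔ P↔) ⊎-↔ Q↔) (↔-sym (↔-trans +↔⊎ (*↔× ⊎-↔ ↔-refl)))

module TilingCount (a b c : ℤ → ℕ) where

  -- Note the length offsets: NotSquareFirst m L describes tilings of L + 1 cells starting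
  -- at m that begin with a domino or a bar, BarFirst m L those of L + 2 cells beginning with a bar.
  NotSquareFirst BarFirst : ℤ → ℕ → Set
  NotSquareFirst m zero    = ⊥
  NotSquareFirst m (suc L) = (Fin (b (m ℤ.+ + 1)) × Tiling a b c (m ℤ.+ + 2) L) ⊎ BarFirst m L
  BarFirst m zero    = ⊥
  BarFirst m (suc L) = Fin (c (m ℤ.+ + 2)) × Tiling a b c (m ℤ.+ + 3) L

  mutual
    tilings notSquareFirst barFirst : ℤ → ℕ → ℕ
    tilings m zero    = 1
    tilings m (suc L) = a m * tilings (m ℤ.+ + 1) L + notSquareFirst m L

    notSquareFirst m zero    = 0
    notSquareFirst m (suc L) = b (m ℤ.+ + 1) * tilings (m ℤ.+ + 2) L + barFirst m L

    barFirst m zero    = 0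
    barFirst m (suc L) = c (m ℤ.+ + 2) * tilings (m ℤ.+ + 3) L

  Tiling-split : ∀ {m L} →
    Tiling a b c m (suc L) ↔ ((Fin (a m) × Tiling a b c (m ℤ.+ + 1) L) ⊎ NotSquareFirst m L)
  Tiling-split = mk↔ₛ′ to from to∘from from∘to
    where
    to : ∀ {m L} → Tiling a b c m (suc L) → (Fin (a m) × Tiling a b c (m ℤ.+ + 1) L) ⊎ NotSquareFirst m L
    to (square h t) = inj₁ (h , t)
    to (domino h t) = inj₂ (inj₁ (h , t))
    to (bar h t)    = inj₂ (inj₂ (h , t))

    from : ∀ {m L} → (Fin (a m) × Tiling a b c (m ℤ.+ + 1) L) ⊎ NotSquareFirst m L → Tiling a b c m (suc L)
    from (inj₁ (h , t))                           = square h t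
    from {L = suc L}       (inj₂ (inj₁ (h , t))) = domino h t
    from {L = suc (suc L)} (inj₂ (inj₂ (h , t))) = bar h t

    to∘from : ∀ {m L} (x : (Fin (a m) × Tiling a b c (m ℤ.+ + 1) L) ⊎ NotSquareFirst m L) → to (from x) ≡ x
    to∘from (inj₁ _)                           = refl
    to∘from {L = suc L}       (inj₂ (inj₁ _)) = refl
    to∘from {L = suc (suc L)} (inj₂ (inj₂ _)) = refl

    from∘to : ∀ {m L} (t : Tiling a b c m (suc L)) → from (to t) ≡ t
    from∘to (square _ _) = refl
    from∘to (domino _ _) = refl
    from∘to (bar _ _)    = refl

  FirstNotSquare↔NotSquareFirst : ∀ {m L} → Σ (Tiling a b c m (suc L)) FirstNotSquare ↔ NotSquareFirst m L
  FirstNotSquare↔NotSquareFirst = mk↔ₛ′ to from to∘from from∘to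
    where
    to : ∀ {m L} → Σ (Tiling a b c m (suc L)) FirstNotSquare → NotSquareFirst m L
    to (domino h t , _) = inj₁ (h , t)
    to (bar h t , _)    = inj₂ (h , t)

    from : ∀ {m L} → NotSquareFirst m L → Σ (Tiling a b c m (suc L)) FirstNotSquare
    from {L = suc L}       (inj₁ (h , t)) = domino h t , tt
    from {L = suc (suc L)} (inj₂ (h , t)) = bar h t , tt

    to∘from : ∀ {m L} (x : NotSquareFirst m L) → to (from x) ≡ x
    to∘from {L = suc L}       (inj₁ _) = refl
    to∘from {L = suc (suc L)} (inj₂ _) = refl

    from∘to : ∀ {m L} (t : Σ (Tiling a b c m (suc L)) FirstNotSquare) → from (to t) ≡ t
    from∘to (domino _ _ , tt) = refl
    from∘to (bar _ _ , tt)    = refl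

  Tiling-empty : ∀ {m} → Tiling a b c m 0 ↔ Fin 1
  Tiling-empty = mk↔ₛ′ (λ _ → zero) (λ _ → empty) (λ { zero → refl }) (λ { empty → refl })

  mutual
    Tiling↔Fin : ∀ m L → Tiling a b c m L ↔ Fin (tilings m L)
    Tiling↔Fin m zero    = Tiling-empty
    Tiling↔Fin m (suc L) = ↔-trans Tiling-split (×⊎↔*+ (Tiling↔Fin _ L) (NotSquareFirst↔Fin m L))

    NotSquareFirst↔Fin : ∀ m L → NotSquareFirst m L ↔ Fin (notSquareFirst m L)
    NotSquareFirst↔Fin m zero    = ↔-sym 0↔⊥
    NotSquareFirst↔Fin m (suc L) = ×⊎↔*+ (Tiling↔Fin _ L) (BarFirst↔Fin m L)

    BarFirst↔Fin : ∀ m L → BarFirst m L ↔ Fin (barFirst m L)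
    BarFirst↔Fin m zero    = ↔-sym 0↔⊥
    BarFirst↔Fin m (suc L) = ↔-trans (↔-refl ×-↔ Tiling↔Fin _ L) (↔-sym *↔×)

infix 4 _≈_

_≈_ : Mat → Mat → Set
X ≈ Y = ∀ i j → X i j ≡ Y i j

≈-refl : ∀ {X} → X ≈ X
≈-refl _ _ = refl

≈-trans : ∀ {X Y Z} → X ≈ Y → Y ≈ Z → X ≈ Z
≈-trans p q i j = trans (p i j) (q i j)

≡⇒≈ : ∀ {X Y} → X ≡ Y → X ≈ Y
≡⇒≈ refl = ≈-refl

⊗-cong : ∀ {X X′ Y Y′} → X ≈ X′ → Y ≈ Y′ → X ⊗ Y ≈ X′ ⊗ Y′
⊗-cong p q i j =
  cong₂ _+_ (cong₂ _*_ (p i 0F) (q 0F j))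
    (cong₂ _+_ (cong₂ _*_ (p i 1F) (q 1F j)) (cong₂ _*_ (p i 2F) (q 2F j)))

⊗-assoc : ∀ X Y Z → (X ⊗ Y) ⊗ Z ≈ X ⊗ (Y ⊗ Z)
⊗-assoc X Y Z i j =
  entry (X i 0F) (X i 1F) (X i 2F)
        (Y 0F 0F) (Y 0F 1F) (Y 0F 2F) (Y 1F 0F) (Y 1F 1F) (Y 1F 2F) (Y 2F 0F) (Y 2F 1F) (Y 2F 2F)
        (Z 0F j) (Z 1F j) (Z 2F j)
  where
  entry : ∀ x₀ x₁ x₂ y₀₀ y₀₁ y₀₂ y₁₀ y₁₁ y₁₂ y₂₀ y₂₁ y₂₂ z₀ z₁ z₂ →
      (x₀ * y₀₀ + (x₁ * y₁₀ + x₂ * y₂₀)) * z₀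
        + ((x₀ * y₀₁ + (x₁ * y₁₁ + x₂ * y₂₁)) * z₁ + (x₀ * y₀₂ + (x₁ * y₁₂ + x₂ * y₂₂)) * z₂)
    ≡ x₀ * (y₀₀ * z₀ + (y₀₁ * z₁ + y₀₂ * z₂))
        + (x₁ * (y₁₀ * z₀ + (y₁₁ * z₁ + y₁₂ * z₂)) + x₂ * (y₂₀ * z₀ + (y₂₁ * z₁ + y₂₂ * z₂)))
  entry = solve-∀

module StepProduct (a b c : ℕ → ℕ) where

  M : ℕ → Mat
  M = stepMat a b c

  M-⊗-row₀ : ∀ s X j → (M s ⊗ X) 0F j ≡ a s * X 0F j + X 1F j
  M-⊗-row₀ s X j = cong (_+_ (a s * X 0F j)) (trans (+-identityʳ _) (*-identityˡ _))

  M-⊗-row₁ : ∀ s X j → (M s ⊗ X) 1F j ≡ b s * X 0F j + X 2F j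
  M-⊗-row₁ s X j = cong (_+_ (b s * X 0F j)) (*-identityˡ _)

  M-⊗-row₂ : ∀ s X j → (M s ⊗ X) 2F j ≡ c s * X 0F j
  M-⊗-row₂ s X j = +-identityʳ _

  -- Nested to the right, so that its first column unfolds along the first piece of a tiling.
  product : ℕ → ℕ → Mat
  product s zero    = M s
  product s (suc L) = M s ⊗ product (suc s) L

  product-snoc : ∀ s L → product s L ⊗ M (s + suc L) ≈ product s (suc L)
  product-snoc s zero    = ⊗-cong (≈-refl {M s}) (≡⇒≈ (cong M (+-comm s 1)))
  product-snoc s (suc L) =
    ≈-trans (⊗-assoc (M s) (product (suc s) L) (M (s + suc (suc L))))
      (⊗-cong (≈-refl {M s}) (≈-trans snoc-index (product-snoc (suc s) L)))
    where
    snoc-index : product (suc s) L ⊗ M (s + suc (suc L)) ≈ product (suc s) L ⊗ M (suc s + suc L)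
    snoc-index = ⊗-cong (≈-refl {product (suc s) L}) (≡⇒≈ (cong M (+-suc s (suc L))))

  prodMat≈product : ∀ n → prodMat a b c n ≈ product 0 n
  prodMat≈product zero    = ≈-refl
  prodMat≈product (suc n) = ≈-trans (⊗-cong (prodMat≈product n) (≈-refl {M (suc n)})) (product-snoc 0 n)

module FirstColumn (a b c : ℕ → ℕ) where
  open StepProduct a b c
  open TilingCount (ext a) (ext b) (ext c)

  cell-shift : ∀ {m s} → m ℤ.+ + 1 ≡ + s → ∀ k → m ℤ.+ + suc k ≡ + (k + s)
  cell-shift {m} {s} m+1≡s k = begin
    m ℤ.+ (+ 1 ℤ.+ + k)  ≡⟨ ℤ.+-assoc m (+ 1) (+ k) ⟨
    m ℤ.+ + 1 ℤ.+ + k    ≡⟨ cong (ℤ._+ + k) m+1≡s ⟩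
    + (s + k)            ≡⟨ cong +_ (+-comm s k) ⟩
    + (k + s)            ∎
    where open ≡-Reasoning

  notSquareFirst-after : ∀ {m s} → m ℤ.+ + 1 ≡ + s → ∀ L →
    notSquareFirst m (suc (suc L)) ≡ b s * tilings (+ suc s) (suc L) + c (suc s) * tilings (+ suc (suc s)) L
  notSquareFirst-after {m} m+1≡s L =
    cong₂ _+_
      (cong₂ _*_ (cong (ext b) m+1≡s) (cong (λ p → tilings p (suc L)) (cell-shift {m} m+1≡s 1)))
      (cong₂ _*_ (cong (ext c) (cell-shift {m} m+1≡s 1)) (cong (λ p → tilings p L) (cell-shift {m} m+1≡s 2)))

  -- Row 1 is stated for every m with m + 1 = s, so that it covers m = −1 when s = 0.
  column : ∀ s L →
      product s L 0F 0F ≡ tilings (+ s) (suc L)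
    × (∀ {m} → m ℤ.+ + 1 ≡ + s → product s L 1F 0F ≡ notSquareFirst m (suc L))
    × product s L 2F 0F ≡ c s * tilings (+ suc s) L
  column s zero =
      sym (trans (+-identityʳ _) (*-identityʳ _))
    , (λ m+1≡s → sym (trans (+-identityʳ _) (trans (*-identityʳ _) (cong (ext b) m+1≡s))))
    , sym (*-identityʳ _)
  column s (suc L) with column (suc s) L
  ... | row₀ , row₁ , row₂ =
      (begin
        product s (suc L) 0F 0F
          ≡⟨ M-⊗-row₀ s (product (suc s) L) 0F ⟩
        a s * product (suc s) L 0F 0F + product (suc s) L 1F 0F
          ≡⟨ cong₂ (λ x y → a s * x + y) row₀ (row₁ s+1≡1+s) ⟩
        a s * tilings (+ suc s) (suc L) + notSquareFirst (+ s) (suc L)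
          ≡⟨ cong (λ p → a s * tilings p (suc L) + notSquareFirst (+ s) (suc L)) s+1≡1+s ⟨
        tilings (+ s) (suc (suc L)) ∎)
    , (λ {m} m+1≡s → begin
        product s (suc L) 1F 0F
          ≡⟨ M-⊗-row₁ s (product (suc s) L) 0F ⟩
        b s * product (suc s) L 0F 0F + product (suc s) L 2F 0F
          ≡⟨ cong₂ (λ x y → b s * x + y) row₀ row₂ ⟩
        b s * tilings (+ suc s) (suc L) + c (suc s) * tilings (+ suc (suc s)) L
          ≡⟨ notSquareFirst-after {m} m+1≡s L ⟨
        notSquareFirst m (suc (suc L)) ∎)
    , trans (M-⊗-row₂ s (product (suc s) L) 0F) (cong (c s *_) row₀)
    where
    open ≡-Reasoning
    s+1≡1+s : + s ℤ.+ + 1 ≡ + suc s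
    s+1≡1+s = cong +_ (+-comm s 1)

  ABC-tilings : ∀ n →
      A a b c n ≡ tilings (+ 0) (suc n)
    × B a b c n ≡ notSquareFirst -[1+ 0 ] (suc n)
    × C a b c n ≡ c 0 * tilings (+ 1) n
  ABC-tilings n with column 0 n
  ... | row₀ , row₁ , row₂ =
      trans (prodMat≈product n 0F 0F) row₀
    , trans (prodMat≈product n 1F 0F) (row₁ refl)
    , trans (prodMat≈product n 2F 0F) row₂

mainTheorem2 : (n : ℕ) (a b c : ℕ → ℕ) → c 0 ≡ 1 →
    (Fin (A a b c n) ↔ Tiling (ext a) (ext b) (ext c) (+ 0) (suc n))
    × (Fin (B a b c n) ↔ Σ (Tiling (ext a) (ext b) (ext c) -[1+ 0 ] (suc (suc n))) FirstNotSquare)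
    × (Fin (C a b c n) ↔ Tiling (ext a) (ext b) (ext c) (+ 1) n)
mainTheorem2 n a b c c₀≡1 with FirstColumn.ABC-tilings a b c n
... | A≡ , B≡ , C≡ =
    counted A≡ (Tiling↔Fin (+ 0) (suc n))
  , counted B≡ (↔-trans FirstNotSquare↔NotSquareFirst (NotSquareFirst↔Fin -[1+ 0 ] (suc n)))
  , counted (trans C≡ (trans (cong (_* tilings (+ 1) n) c₀≡1) (*-identityˡ _))) (Tiling↔Fin (+ 1) n)
  where
  open TilingCount (ext a) (ext b) (ext c)
  counted : ∀ {x y} {T : Set} → x ≡ y → T ↔ Fin y → Fin x ↔ T
  counted x≡y T↔ = ↔-trans (Fin-cong x≡y) (↔-sym T↔)
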